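{- Let $\mathfrak A$ be a J-algebra, let $e\in A$ with $e\le1'$, and let $X=\{x\in A: x;x^{\smile}=e=x^{\smile};x\}$. Then $\langle X,;,{}^{\smile},e\rangle$ is a group.
   Context: A J-algebra is an algebra $\langle A,\cdot,0,1,;,{}^{\smile},1'\rangle$ satisfying for all $x,y,z$: $x\cdot(y\cdot z)=(x\cdot y)\cdot z$, $x\cdot y=y\cdot x$, $x\cdot x=x$, $x;(y;z)=(x;y);z$, $x;1'=x$, $(x\cdot y);z=(x\cdot y);z\cdot y;z$, $x^{\smile\smile}=x$, $(x;y)^{\smile}=y^{\smile};x^{\smile}$, $(x\cdot y)^{\smile}=x^{\smile}\cdot y^{\smile}$, $x;y\cdot z=(z;y^{\smile}\cdot x);(y\cdot x^{\smile};z)\cdot z$, $0\cdot x=0$, $x\cdot1=x$, $x;0=0$. Converse binds tightest, then $;$, then $\cdot$. $x\le y$ means $x\cdot y=x$. -}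

module Defs where

open import Level using (Level; suc; _⊔_)
open import Data.Product using (Σ; _,_; proj₁; proj₂; _×_)
open import Relation.Binary.PropositionalEquality using (_≡_)
open import Algebra.Structures using (IsGroup)

record JAlgebra (a : Level) : Set (suc a) where
  infixr 7 _⨾_
  infixr 6 _·_
  field
    A     : Set a
    _·_   : A → A → A
    𝟘     : A
    𝟙     : A
    _⨾_   : A → A → A
    _˘    : A → A
    1'    : A
    ·-assoc  : ∀ x y z → x · (y · z) ≡ (x · y) · z
    ·-comm   : ∀ x y → x · y ≡ y · x
    ·-idem   : ∀ x → x · x ≡ x
    ⨾-assoc  : ∀ x y z → x ⨾ (y ⨾ z) ≡ (x ⨾ y) ⨾ z
    ⨾-1'     : ∀ x → x ⨾ 1' ≡ x
    ⨾-·-dist : ∀ x y z → (x · y) ⨾ z ≡ ((x · y) ⨾ z) · (y ⨾ z)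
    ˘˘       : ∀ x → (x ˘) ˘ ≡ x
    ˘-⨾      : ∀ x y → (x ⨾ y) ˘ ≡ (y ˘) ⨾ (x ˘)
    ˘-·      : ∀ x y → (x · y) ˘ ≡ (x ˘) · (y ˘)
    J-law    : ∀ x y z → (x ⨾ y) · z ≡ (((z ⨾ (y ˘)) · x) ⨾ (y · ((x ˘) ⨾ z))) · z
    𝟘-·      : ∀ x → 𝟘 · x ≡ 𝟘
    ·-𝟙      : ∀ x → x · 𝟙 ≡ x
    ⨾-𝟘      : ∀ x → x ⨾ 𝟘 ≡ 𝟘

  infix 4 _≤_
  _≤_ : A → A → Set a
  x ≤ y = x · y ≡ x

module _ {a : Level} (𝔄 : JAlgebra a) where
  open JAlgebra 𝔄

  InX : A → A → Set a
  InX e x = (x ⨾ (x ˘) ≡ e) × (e ≡ (x ˘) ⨾ x)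

  X : A → Set a
  X e = Σ A (InX e)

  _≈X_ : ∀ {e} → X e → X e → Set a
  u ≈X v = proj₁ u ≡ proj₁ v

  IsGroupOnX : A → Set a
  IsGroupOnX e =
    Σ (∀ x y → InX e x → InX e y → InX e (x ⨾ y)) λ cl⨾ →
    Σ (∀ x → InX e x → InX e (x ˘)) λ cl˘ →
    Σ (InX e e) λ e∈X →
      IsGroup (_≈X_ {e})
        (λ u v → (proj₁ u ⨾ proj₁ v) , cl⨾ (proj₁ u) (proj₁ v) (proj₂ u) (proj₂ v))
        (e , e∈X)
        (λ u → (proj₁ u ˘) , cl˘ (proj₁ u) (proj₂ u))

{-# OPTIONS --safe #-}

-- Every subidentity d ≤ 1' is symmetric and idempotent, and the domain
-- (x ⨾ x˘) · 1' of any x is a left identity for x.  For x ∈ X the domain is e,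
-- so e is a left identity on X and, via x ⨾ e = x ⨾ x˘ ⨾ x = e ⨾ x, also a right
-- identity; x˘ is an inverse of x by the very definition of X, and
-- associativity is inherited from ⨾.
module Submission where

open import Level using (Level)
open import Defs
open import Data.Product using (_,_; proj₁; proj₂)
open import Relation.Binary.PropositionalEquality
open import Relation.Binary.Construct.On as On using ()
open import Algebra.Structures using (IsGroup)

module JAlgebraProperties {a : Level} (𝔄 : JAlgebra a) where
  open JAlgebra 𝔄
  open ≡-Reasoning

  1'˘-⨾ : ∀ x → (1' ˘) ⨾ x ≡ x
  1'˘-⨾ x = begin
    (1' ˘) ⨾ x         ≡⟨ cong ((1' ˘) ⨾_) (sym (˘˘ x)) ⟩
    (1' ˘) ⨾ ((x ˘) ˘) ≡⟨ sym (˘-⨾ (x ˘) 1') ⟩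
    ((x ˘) ⨾ 1') ˘     ≡⟨ cong _˘ (⨾-1' (x ˘)) ⟩
    (x ˘) ˘            ≡⟨ ˘˘ x ⟩
    x                  ∎

  1'˘ : 1' ˘ ≡ 1'
  1'˘ = trans (sym (⨾-1' (1' ˘))) (1'˘-⨾ 1')

  1'-⨾ : ∀ x → 1' ⨾ x ≡ x
  1'-⨾ x = trans (cong (_⨾ x) (sym 1'˘)) (1'˘-⨾ x)

  ≤-trans : ∀ {x y z} → x ≤ y → y ≤ z → x ≤ z
  ≤-trans {x} {y} {z} x≤y y≤z = begin
    x · z       ≡⟨ cong (_· z) (sym x≤y) ⟩
    (x · y) · z ≡⟨ sym (·-assoc x y z) ⟩
    x · (y · z) ≡⟨ cong (x ·_) y≤z ⟩
    x · y       ≡⟨ x≤y ⟩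
    x           ∎

  ≤-antisym : ∀ {x y} → x ≤ y → y ≤ x → x ≡ y
  ≤-antisym {x} {y} x≤y y≤x = trans (sym x≤y) (trans (·-comm x y) y≤x)

  ˘-mono-≤ : ∀ {x y} → x ≤ y → x ˘ ≤ y ˘
  ˘-mono-≤ {x} {y} x≤y = trans (sym (˘-· x y)) (cong _˘ x≤y)

  ⨾-monoˡ-≤ : ∀ {x y} z → x ≤ y → x ⨾ z ≤ y ⨾ z
  ⨾-monoˡ-≤ {x} {y} z x≤y = begin
    (x ⨾ z) · (y ⨾ z)       ≡⟨ cong (λ w → (w ⨾ z) · (y ⨾ z)) (sym x≤y) ⟩
    ((x · y) ⨾ z) · (y ⨾ z) ≡⟨ sym (⨾-·-dist x y z) ⟩
    (x · y) ⨾ z             ≡⟨ cong (_⨾ z) x≤y ⟩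
    x ⨾ z                   ∎

  ≤1'⇒⨾-≤ : ∀ {d} z → d ≤ 1' → d ⨾ z ≤ z
  ≤1'⇒⨾-≤ {d} z d≤1' = subst (d ⨾ z ≤_) (1'-⨾ z) (⨾-monoˡ-≤ z d≤1')

  x·y≤x : ∀ x y → x · y ≤ x
  x·y≤x x y = begin
    (x · y) · x ≡⟨ ·-comm (x · y) x ⟩
    x · (x · y) ≡⟨ ·-assoc x x y ⟩
    (x · x) · y ≡⟨ cong (_· y) (·-idem x) ⟩
    x · y       ∎

  x·y≤y : ∀ x y → x · y ≤ y
  x·y≤y x y = subst (_≤ y) (·-comm y x) (x·y≤x y x)

  ≤-domain-⨾ : ∀ x → x ≤ ((x ⨾ (x ˘)) · 1') ⨾ x
  ≤-domain-⨾ x = begin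
    x · (δ ⨾ x)                   ≡⟨ ·-comm x (δ ⨾ x) ⟩
    (δ ⨾ x) · x                   ≡⟨ cong (λ w → (δ ⨾ w) · x) (sym (·-idem x)) ⟩
    (δ ⨾ (x · x)) · x             ≡⟨ cong (λ w → (δ ⨾ (x · w)) · x) (sym (1'˘-⨾ x)) ⟩
    (δ ⨾ (x · ((1' ˘) ⨾ x))) · x  ≡⟨ sym (J-law 1' x x) ⟩
    (1' ⨾ x) · x                  ≡⟨ cong (_· x) (1'-⨾ x) ⟩
    x · x                         ≡⟨ ·-idem x ⟩
    x                             ∎
    where
    δ = (x ⨾ (x ˘)) · 1'

  domain-⨾ : ∀ x → ((x ⨾ (x ˘)) · 1') ⨾ x ≡ x
  domain-⨾ x = ≤-antisym (≤1'⇒⨾-≤ x (x·y≤y (x ⨾ (x ˘)) 1')) (≤-domain-⨾ x)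

  ≤1'⇒≡domain : ∀ {d} → d ≤ 1' → d ≡ (d ⨾ (d ˘)) · 1'
  ≤1'⇒≡domain {d} d≤1' = begin
    d                                          ≡⟨ sym d≤1' ⟩
    d · 1'                                     ≡⟨ cong (_· 1') (sym (⨾-1' d)) ⟩
    (d ⨾ 1') · 1'                              ≡⟨ J-law d 1' 1' ⟩
    ((1' ⨾ (1' ˘)) · d) ⨾ (1' · ((d ˘) ⨾ 1')) · 1'
      ≡⟨ cong₂ (λ u v → (u · d) ⨾ (1' · v) · 1') (trans (1'-⨾ (1' ˘)) 1'˘) (⨾-1' (d ˘)) ⟩
    (1' · d) ⨾ (1' · (d ˘)) · 1'
      ≡⟨ cong₂ (λ u v → u ⨾ v · 1') (trans (·-comm 1' d) d≤1') (trans (·-comm 1' (d ˘)) d˘≤1') ⟩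
    (d ⨾ (d ˘)) · 1'                           ∎
    where
    d˘≤1' : d ˘ ≤ 1'
    d˘≤1' = subst (d ˘ ≤_) 1'˘ (˘-mono-≤ d≤1')

  ≤1'⇒⨾-idem : ∀ {d} → d ≤ 1' → d ⨾ d ≡ d
  ≤1'⇒⨾-idem {d} d≤1' = trans (cong (_⨾ d) (≤1'⇒≡domain d≤1')) (domain-⨾ d)

  ≤1'⇒≤˘ : ∀ {d} → d ≤ 1' → d ≤ d ˘
  ≤1'⇒≤˘ {d} d≤1' = ≤-trans d≤d⨾d˘ (≤1'⇒⨾-≤ (d ˘) d≤1')
    where
    d≤d⨾d˘ : d ≤ d ⨾ (d ˘)
    d≤d⨾d˘ = subst (_≤ d ⨾ (d ˘)) (sym (≤1'⇒≡domain d≤1')) (x·y≤x (d ⨾ (d ˘)) 1')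

  ≤1'⇒˘≡ : ∀ {d} → d ≤ 1' → d ˘ ≡ d
  ≤1'⇒˘≡ {d} d≤1' = ≤-antisym d˘≤d (≤1'⇒≤˘ d≤1')
    where
    d˘≤d : d ˘ ≤ d
    d˘≤d = subst (d ˘ ≤_) (˘˘ d) (˘-mono-≤ (≤1'⇒≤˘ d≤1'))

module GroupOfX {a : Level} (𝔄 : JAlgebra a) {e : JAlgebra.A 𝔄}
                (e≤1' : JAlgebra._≤_ 𝔄 e (JAlgebra.1' 𝔄)) where
  open JAlgebra 𝔄
  open JAlgebraProperties 𝔄
  open ≡-Reasoning

  e∈X : InX 𝔄 e e
  e∈X = ee˘≡e , sym (trans (cong (_⨾ e) (≤1'⇒˘≡ e≤1')) (≤1'⇒⨾-idem e≤1'))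
    where
    ee˘≡e : e ⨾ (e ˘) ≡ e
    ee˘≡e = trans (cong (e ⨾_) (≤1'⇒˘≡ e≤1')) (≤1'⇒⨾-idem e≤1')

  X-identityˡ : ∀ {x} → InX 𝔄 e x → e ⨾ x ≡ x
  X-identityˡ {x} (x⨾x˘≡e , _) = begin
    e ⨾ x                    ≡⟨ cong (_⨾ x) (sym e≤1') ⟩
    (e · 1') ⨾ x             ≡⟨ cong (λ w → (w · 1') ⨾ x) (sym x⨾x˘≡e) ⟩
    ((x ⨾ (x ˘)) · 1') ⨾ x   ≡⟨ domain-⨾ x ⟩
    x                        ∎

  X-identityʳ : ∀ {x} → InX 𝔄 e x → x ⨾ e ≡ x
  X-identityʳ {x} x∈X@(x⨾x˘≡e , e≡x˘⨾x) = begin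
    x ⨾ e              ≡⟨ cong (x ⨾_) e≡x˘⨾x ⟩
    x ⨾ ((x ˘) ⨾ x)    ≡⟨ ⨾-assoc x (x ˘) x ⟩
    (x ⨾ (x ˘)) ⨾ x    ≡⟨ cong (_⨾ x) x⨾x˘≡e ⟩
    e ⨾ x              ≡⟨ X-identityˡ x∈X ⟩
    x                  ∎

  X-closed-˘ : ∀ x → InX 𝔄 e x → InX 𝔄 e (x ˘)
  X-closed-˘ x (x⨾x˘≡e , e≡x˘⨾x) =
    trans (cong ((x ˘) ⨾_) (˘˘ x)) (sym e≡x˘⨾x) ,
    trans (sym x⨾x˘≡e) (cong (_⨾ (x ˘)) (sym (˘˘ x)))

  ⨾-cancel-middle : ∀ {x y z w} → y ⨾ z ≡ e → e ⨾ w ≡ w → (x ⨾ y) ⨾ (z ⨾ w) ≡ x ⨾ w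
  ⨾-cancel-middle {x} {y} {z} {w} y⨾z≡e e⨾w≡w = begin
    (x ⨾ y) ⨾ (z ⨾ w)  ≡⟨ sym (⨾-assoc x y (z ⨾ w)) ⟩
    x ⨾ (y ⨾ (z ⨾ w))  ≡⟨ cong (x ⨾_) (⨾-assoc y z w) ⟩
    x ⨾ ((y ⨾ z) ⨾ w)  ≡⟨ cong (λ v → x ⨾ (v ⨾ w)) y⨾z≡e ⟩
    x ⨾ (e ⨾ w)        ≡⟨ cong (x ⨾_) e⨾w≡w ⟩
    x ⨾ w              ∎

  X-closed-⨾ : ∀ x y → InX 𝔄 e x → InX 𝔄 e y → InX 𝔄 e (x ⨾ y)
  X-closed-⨾ x y x∈X@(x⨾x˘≡e , e≡x˘⨾x) y∈X@(y⨾y˘≡e , e≡y˘⨾y) =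
    trans (cong ((x ⨾ y) ⨾_) (˘-⨾ x y))
      (trans (⨾-cancel-middle y⨾y˘≡e (X-identityˡ (X-closed-˘ x x∈X))) x⨾x˘≡e) ,
    sym (trans (cong (_⨾ (x ⨾ y)) (˘-⨾ x y))
      (trans (⨾-cancel-middle (sym e≡x˘⨾x) (X-identityˡ y∈X)) (sym e≡y˘⨾y)))

  isGroupOnX : IsGroupOnX 𝔄 e
  isGroupOnX = X-closed-⨾ , X-closed-˘ , e∈X , record
    { isMonoid = record
      { isSemigroup = record
        { isMagma = record
          { isEquivalence = On.isEquivalence proj₁ isEquivalence
          ; ∙-cong = cong₂ _⨾_
          }
        ; assoc = λ u v w → sym (⨾-assoc (proj₁ u) (proj₁ v) (proj₁ w))
        }
      ; identity = (λ u → X-identityˡ (proj₂ u)) , (λ u → X-identityʳ (proj₂ u))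
      }
    ; inverse = (λ u → sym (proj₂ (proj₂ u))) , (λ u → proj₁ (proj₂ u))
    ; ⁻¹-cong = cong _˘
    }

proposition51 : ∀ {a : Level} (𝔄 : JAlgebra a) (e : JAlgebra.A 𝔄) →
    JAlgebra._≤_ 𝔄 e (JAlgebra.1' 𝔄) → IsGroupOnX 𝔄 e
proposition51 𝔄 e e≤1' = GroupOfX.isGroupOnX 𝔄 e≤1'
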